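{- Every binary string of length $7$ is reconstructable: if $s,t\in\{0,1\}^7$ are equicomposable, then $t=s$ or $t=s^*$.
   Context: For a binary string $s=s_1\cdots s_n$, its composition multiset is the multiset $\mathcal S_s=\{\{s_i,s_{i+1},\dots,s_j\}:1\le i\le j\le n\}$ of the compositions (multisets of symbols, i.e. numbers of 0's and 1's) of all $\binom{n+1}{2}$ contiguous substrings, counted with multiplicity. Two strings $s,t$ are equicomposable ($s\sim t$) if $\mathcal S_s=\mathcal S_t$. The reversal of $s$ is $s^*=s_ns_{n-1}\cdots s_1$. A string is reconstructable if it is equicomposable only with itself and its reversal. -}

module Defs where

open import Data.Bool using (Bool; true; false)
open import Data.Nat using (ℕ; zero; suc)
open import Data.Product using (_×_; _,_)
open import Data.List using (List; []; _∷_; _++_; map; reverse)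
open import Relation.Binary.PropositionalEquality using (_≡_)
open import Data.Sum using (_⊎_)
open import Data.List.Relation.Binary.Permutation.Propositional using (_↭_)

-- A binary string is a list of bits (false = 0, true = 1).
BinString : Set
BinString = List Bool

composition : BinString → ℕ × ℕ
composition [] = (0 , 0)
composition (false ∷ s) with composition s
... | (a , b) = (suc a , b)
composition (true ∷ s) with composition s
... | (a , b) = (a , suc b)

nonemptyPrefixes : BinString → List BinString
nonemptyPrefixes [] = []
nonemptyPrefixes (x ∷ s) = (x ∷ []) ∷ map (x ∷_) (nonemptyPrefixes s)

-- All contiguous substrings s_i⋯s_j (1 ≤ i ≤ j ≤ n), listed with multiplicity
-- (one entry per pair (i , j)).
substrings : BinString → List BinString
substrings [] = []
substrings (x ∷ s) = nonemptyPrefixes (x ∷ s) ++ substrings s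

compositionMultiset : BinString → List (ℕ × ℕ)
compositionMultiset s = map composition (substrings s)

-- Equicomposability: equal composition multisets (equality of multisets = permutation).
_∼_ : BinString → BinString → Set
s ∼ t = compositionMultiset s ↭ compositionMultiset t

Reconstructable : BinString → Set
Reconstructable s = ∀ (t : BinString) → s ∼ t → (t ≡ s) ⊎ (t ≡ reverse s)

-- Equicomposable strings have equally many substrings, n(n+1)/2, hence equal length,
-- and every composition occurs in both with the same multiplicity.  So it suffices to
-- check, among the 128 strings of length 7, that any two with the same multiplicity
-- profile are equal or reverses of each other; that finite check is decided by evaluation.
module Submission where

open import Data.Bool using (false; true)
import Data.Bool.Properties as Bool
open import Data.Empty using (⊥-elim)
open import Data.List using (List; []; _∷_; _++_; map; reverse; length; filter; cartesianProduct; upTo)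
open import Data.List.Membership.Propositional using (_∈_)
open import Data.List.Membership.Propositional.Properties using (∈-++⁺ˡ; ∈-++⁺ʳ; ∈-map⁺)
open import Data.List.Properties using (length-++; length-map)
import Data.List.Properties as List
open import Data.List.Relation.Binary.Permutation.Propositional using (_↭_)
open import Data.List.Relation.Binary.Permutation.Propositional.Properties using (↭-length; filter-↭)
open import Data.List.Relation.Unary.All as All using (All; all?)
open import Data.List.Relation.Unary.Any using (here)
open import Data.Nat using (ℕ; zero; suc; _+_; _≤_; _<_; z≤n; s≤s; z<s)
open import Data.Nat.Properties using (<-cmp; <-irrefl; ≤-<-trans; +-mono-≤; m<n+m)
import Data.Nat.Properties as ℕ
open import Data.Product using (_×_; _,_)
import Data.Product.Properties as Product
open import Data.Sum using (_⊎_)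
open import Function using (_∘_)
open import Relation.Binary.Definitions using (DecidableEquality; tri<; tri≈; tri>)
open import Relation.Binary.PropositionalEquality
  using (_≡_; refl; sym; trans; cong; cong₂; subst; module ≡-Reasoning)
open import Relation.Nullary.Decidable using (Dec; toWitness; _→-dec_; _⊎-dec_)

open import Defs

triangle : ℕ → ℕ
triangle zero    = 0
triangle (suc n) = suc n + triangle n

triangle-mono-≤ : ∀ {m n} → m ≤ n → triangle m ≤ triangle n
triangle-mono-≤ z≤n       = z≤n
triangle-mono-≤ (s≤s m≤n) = +-mono-≤ (s≤s m≤n) (triangle-mono-≤ m≤n)

triangle-mono-< : ∀ {m n} → m < n → triangle m < triangle n
triangle-mono-< {n = suc n} (s≤s m≤n) = ≤-<-trans (triangle-mono-≤ m≤n) (m<n+m (triangle n) z<s)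

triangle-injective : ∀ {m n} → triangle m ≡ triangle n → m ≡ n
triangle-injective {m} {n} eq with <-cmp m n
... | tri< m<n _ _ = ⊥-elim (<-irrefl eq (triangle-mono-< m<n))
... | tri≈ _ m≡n _ = m≡n
... | tri> _ _ n<m = ⊥-elim (<-irrefl (sym eq) (triangle-mono-< n<m))

length-nonemptyPrefixes : ∀ s → length (nonemptyPrefixes s) ≡ length s
length-nonemptyPrefixes []      = refl
length-nonemptyPrefixes (x ∷ s) =
  cong suc (trans (length-map (x ∷_) (nonemptyPrefixes s)) (length-nonemptyPrefixes s))

length-substrings : ∀ s → length (substrings s) ≡ triangle (length s)
length-substrings []      = refl
length-substrings (x ∷ s) =
  trans (length-++ (nonemptyPrefixes (x ∷ s)))
        (cong₂ _+_ (length-nonemptyPrefixes (x ∷ s)) (length-substrings s))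

∼⇒length≡ : ∀ {s t} → s ∼ t → length s ≡ length t
∼⇒length≡ {s} {t} s∼t = triangle-injective (begin
  triangle (length s)                  ≡⟨ sym (length-substrings s) ⟩
  length (substrings s)                ≡⟨ sym (length-map composition (substrings s)) ⟩
  length (compositionMultiset s)       ≡⟨ ↭-length s∼t ⟩
  length (compositionMultiset t)       ≡⟨ length-map composition (substrings t) ⟩
  length (substrings t)                ≡⟨ length-substrings t ⟩
  triangle (length t)                  ∎)
  where open ≡-Reasoning

_≟ᶜ_ : DecidableEquality (ℕ × ℕ)
_≟ᶜ_ = Product.≡-dec ℕ._≟_ ℕ._≟_

multiplicity : ℕ × ℕ → List (ℕ × ℕ) → ℕ
multiplicity c = length ∘ filter (_≟ᶜ c)

multiplicity-↭ : ∀ c {xs ys} → xs ↭ ys → multiplicity c xs ≡ multiplicity c ys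
multiplicity-↭ c = ↭-length ∘ filter-↭ (_≟ᶜ c)

profile : List (ℕ × ℕ) → BinString → List ℕ
profile cs s = map (λ c → multiplicity c (compositionMultiset s)) cs

∼⇒profile≡ : ∀ cs {s t} → s ∼ t → profile cs s ≡ profile cs t
∼⇒profile≡ []               s∼t = refl
∼⇒profile≡ (c ∷ cs) {s} {t} s∼t = cong₂ _∷_ (multiplicity-↭ c s∼t) (∼⇒profile≡ cs {s} {t} s∼t)

bitStrings : ℕ → List BinString
bitStrings zero    = [] ∷ []
bitStrings (suc n) = map (false ∷_) (bitStrings n) ++ map (true ∷_) (bitStrings n)

∈-bitStrings : ∀ s → s ∈ bitStrings (length s)
∈-bitStrings []          = here refl
∈-bitStrings (false ∷ s) = ∈-++⁺ˡ (∈-map⁺ (false ∷_) (∈-bitStrings s))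
∈-bitStrings (true ∷ s)  = ∈-++⁺ʳ _ (∈-map⁺ (true ∷_) (∈-bitStrings s))

EqualOrReversed : BinString → BinString → Set
EqualOrReversed s t = (t ≡ s) ⊎ (t ≡ reverse s)

equalOrReversed? : ∀ s t → Dec (EqualOrReversed s t)
equalOrReversed? s t = (t ≟ s) ⊎-dec (t ≟ reverse s)
  where _≟_ = List.≡-dec Bool._≟_

-- Profiles are stored in the table rather than recomputed from the strings: the
-- table is a variable of separating?, so evaluation computes each profile only once.
Separating : List (BinString × List ℕ) → Set
Separating table =
  All (λ (s , p) → All (λ (t , q) → p ≡ q → EqualOrReversed s t) table) table

separating? : ∀ table → Dec (Separating table)
separating? table =
  all? (λ (s , p) → all? (λ (t , q) → List.≡-dec ℕ._≟_ p q →-dec equalOrReversed? s t) table) table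

profiledStrings : List (ℕ × ℕ) → ℕ → List (BinString × List ℕ)
profiledStrings cs n = map (λ s → s , profile cs s) (bitStrings n)

separating⇒reconstructable : ∀ cs n → Separating (profiledStrings cs n) →
                             ∀ s → length s ≡ n → Reconstructable s
separating⇒reconstructable cs _ separating s refl t s∼t =
  All.lookup (All.lookup separating (profiled s refl)) (profiled t (∼⇒length≡ {s} {t} s∼t))
             (∼⇒profile≡ cs {s} {t} s∼t)
  where
  profiled : ∀ u → length s ≡ length u → (u , profile cs u) ∈ profiledStrings cs (length s)
  profiled u eq = ∈-map⁺ _ (subst (λ m → u ∈ bitStrings m) (sym eq) (∈-bitStrings u))

compositionsUpTo : ℕ → List (ℕ × ℕ)
compositionsUpTo n = cartesianProduct (upTo (suc n)) (upTo (suc n))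

theorem4 : ∀ (s : BinString) → length s ≡ 7 → Reconstructable s
theorem4 = separating⇒reconstructable (compositionsUpTo 7) 7
  (toWitness {a? = separating? (profiledStrings (compositionsUpTo 7) 7)} _)
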